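{- If $\varphi$ is a partial $d$-edge coloring of $Q_d$ in which all colored edges are contained in the union of $\lfloor d/3\rfloor$ dimensional matchings, then $\varphi$ is avoidable.
   Context: $Q_d$ is the hypercube on $\{0,1\}^d$; the $i$-th dimensional matching consists of the edges whose endpoints differ in coordinate $i$. A partial $d$-edge coloring assigns colors from $\{1,\dots,d\}$ to some subset of edges (not necessarily properly); it is avoidable if there is a proper $d$-edge coloring $f$ of $Q_d$ with colors $1,\dots,d$ such that $f(e)\neq\varphi(e)$ for every colored edge $e$. -}

module Defs where

open import Data.Nat using (ℕ)
open import Data.Bool using (Bool; not)
open import Data.Fin using (Fin)
open import Data.Vec using (Vec; lookup; updateAt)
open import Data.Maybe using (Maybe; just)
open import Data.Product using (Σ; _×_)
open import Relation.Binary.PropositionalEquality using (_≡_; _≢_)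

Vertex : ℕ → Set
Vertex d = Vec Bool d

-- flip coordinate i; the edge {v , flip i v} is the edge at v in dimension i
flip : ∀ {d} → Fin d → Vertex d → Vertex d
flip i v = updateAt v i not

-- Each edge of Q_d is determined by an endpoint v and its direction i; an
-- edge labelling is a function of (v , i) that agrees at both endpoints.
WellDefinedOnEdges : ∀ {d} {A : Set} → (Vertex d → Fin d → A) → Set
WellDefinedOnEdges {d} g = ∀ (v : Vertex d) (i : Fin d) → g v i ≡ g (flip i v) i

EdgeColoring : ℕ → Set
EdgeColoring d = Vertex d → Fin d → Fin d

-- A partial d-edge coloring: nothing = uncolored edge (not necessarily proper)
PartialColoring : ℕ → Set
PartialColoring d = Vertex d → Fin d → Maybe (Fin d)

Proper : ∀ {d} → EdgeColoring d → Set
Proper {d} f = ∀ (v : Vertex d) (i j : Fin d) → i ≢ j → f v i ≢ f v j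

Avoidable : ∀ {d} → PartialColoring d → Set
Avoidable {d} φ =
  Σ (EdgeColoring d) λ f → WellDefinedOnEdges f × Proper f ×
     (∀ (v : Vertex d) (i : Fin d) (c : Fin d) → φ v i ≡ just c → f v i ≢ c)

-- Pair every colored dimension i ∈ S with two dimensions j, k ∉ S, all these
-- triples disjoint, which is possible since 3 ∣S∣ ≤ d.  Start from the coloring
-- giving each edge of dimension l the color l, and recolor the edges of each
-- triple with the colors i, j, k, working inside the 3-cubes they span: the
-- i-edge at v and its parallel copy at flip j v get a common color avoiding φ
-- on both, each k-edge the color avoiding the i-colors at its two ends, and
-- each j-edge the remaining color.  These rules are constant along the edges
-- they color and give three distinct colors at every vertex, and the other
-- dimensions keep colors outside {i, j, k}, so properness is preserved.
module Submission where

open import Defs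
open import Data.Nat using (ℕ; _≤_; _/_)
open import Data.Fin using (Fin)
open import Data.Fin.Subset using (Subset; _∈_; ∣_∣)
open import Data.Maybe using (just)
open import Relation.Binary.PropositionalEquality using (_≡_)

open import Data.Nat using (_*_; _+_; _∸_; s≤s)
open import Data.Nat.Properties
  using (*-monoˡ-≤; *-suc; +-comm; m+n≤o⇒m≤o∸n; module ≤-Reasoning)
open import Data.Nat.DivMod using (m/n*n≤m)
open import Data.Fin using (zero; suc; _≟_)
open import Data.Fin.Properties using (suc-injective)
open import Data.Fin.Subset using (∁; inside; outside)
open import Data.Fin.Subset.Properties using (x∈p⇒x∉∁p; ∣∁p∣≡n∸∣p∣)
open import Data.Bool using (Bool; true; false; not; _∨_; if_then_else_)
open import Data.Bool.Properties using (not-involutive; ∨-comm)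
open import Data.Vec using ([]; _∷_; here; there; updateAt)
open import Data.Vec.Properties using (updateAt-updateAt; updateAt-cong; updateAt-id; updateAt-commutes)
open import Data.Maybe using (Maybe)
open import Data.Maybe.Properties using (just-injective) renaming (≡-dec to ≡-dec-Maybe)
open import Data.List using (List; []; _∷_; map; length)
open import Data.List.Properties using (length-map)
open import Data.List.Membership.Propositional using () renaming (_∈_ to _∈ₗ_; _∉_ to _∉ₗ_)
open import Data.List.Membership.Propositional.Properties using (∈-map⁺; ∈-map⁻; ∈-++⁺ˡ; ∈-++⁺ʳ)
import Data.List.Membership.DecPropositional as DecMembership
open import Data.List.Relation.Unary.Any using (here; there)
open import Data.List.Relation.Unary.All using (All; []; _∷_; universal)
open import Data.List.Relation.Unary.All.Properties using (All¬⇒¬Any; ¬Any⇒All¬)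
import Data.List.Relation.Unary.All.Properties as All
open import Data.List.Relation.Unary.AllPairs using ([]; _∷_)
open import Data.List.Relation.Unary.Unique.Propositional using (Unique)
import Data.List.Relation.Unary.Unique.Propositional.Properties as Unique
open import Data.List.Relation.Binary.Disjoint.Propositional using (Disjoint)
open import Data.Product using (Σ-syntax; _×_; _,_; proj₁)
open import Data.Sum using (_⊎_; inj₁; inj₂)
open import Data.Empty using (⊥-elim)
open import Function using (id; _∘_)
open import Relation.Nullary using (Dec; yes; no; does)
open import Relation.Binary.PropositionalEquality
  using (_≢_; refl; sym; trans; cong; cong₂; subst; ≢-sym; module ≡-Reasoning)

flip-involutive : ∀ {d} (i : Fin d) (v : Vertex d) → flip i (flip i v) ≡ v
flip-involutive i v = begin
  updateAt (updateAt v i not) i not  ≡⟨ updateAt-updateAt i v ⟩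
  updateAt v i (not ∘ not)           ≡⟨ updateAt-cong i not-involutive v ⟩
  updateAt v i id                    ≡⟨ updateAt-id i v ⟩
  v                                  ∎
  where open ≡-Reasoning

record ProperColoring (d : ℕ) : Set where
  field
    color       : EdgeColoring d
    wellDefined : WellDefinedOnEdges color
    proper      : Proper color

open ProperColoring

identityColoring : ∀ {d} → ProperColoring d
identityColoring = record
  { color       = λ _ l → l
  ; wellDefined = λ _ _ → refl
  ; proper      = λ _ _ _ l≢m → l≢m
  }

triple : ∀ {d} → Fin d → Fin d → Fin d → List (Fin d)
triple i j k = i ∷ j ∷ k ∷ []

module _ {d : ℕ} {i j k : Fin d} (i≢j : i ≢ j) (i≢k : i ≢ k) (j≢k : j ≢ k) where

  open DecMembership (_≟_ {d}) using (_∈?_)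

  private
    _≟ₘ_ : (x y : Maybe (Fin d)) → Dec (x ≡ y)
    _≟ₘ_ = ≡-dec-Maybe _≟_

    free : Fin d → Maybe (Fin d) → Maybe (Fin d) → Bool
    free c x y = not (does (x ≟ₘ just c) ∨ does (y ≟ₘ just c))

    free-comm : ∀ c x y → free c x y ≡ free c y x
    free-comm c x y = cong not (∨-comm (does (x ≟ₘ just c)) (does (y ≟ₘ just c)))

    free⇒≢ : ∀ {c} x y → free c x y ≡ true → x ≢ just c
    free⇒≢ {c} x y _ with x ≟ₘ just c
    free⇒≢ x y () | yes _
    ... | no x≢c = x≢c

    non-free⇒≡ : ∀ {c} x y → free c x y ≡ false → x ≡ just c ⊎ y ≡ just c
    non-free⇒≡ {c} x y _ with x ≟ₘ just c | y ≟ₘ just c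
    ... | yes x≡c | _      = inj₁ x≡c
    ... | no _    | yes y≡c = inj₂ y≡c
    non-free⇒≡ x y () | no _ | no _

  -- The first of i, j, k different from both x and y: at most two are blocked.
  third : Maybe (Fin d) → Maybe (Fin d) → Fin d
  third x y = if free i x y then i else if free j x y then j else k

  third-comm : ∀ x y → third x y ≡ third y x
  third-comm x y rewrite free-comm i x y | free-comm j x y = refl

  third-∈ : ∀ x y → third x y ∈ₗ triple i j k
  third-∈ x y with free i x y
  ... | true = here refl
  ... | false with free j x y
  ...   | true  = there (here refl)
  ...   | false = there (there (here refl))

  third-avoidsˡ : ∀ x y → x ≢ just (third x y)
  third-avoidsˡ x y with free i x y in i-free
  ... | true = free⇒≢ x y i-free
  ... | false with free j x y in j-free
  ...   | true  = free⇒≢ x y j-free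
  ...   | false = k-free (non-free⇒≡ x y i-free) (non-free⇒≡ x y j-free)
    where
    k-free : x ≡ just i ⊎ y ≡ just i → x ≡ just j ⊎ y ≡ just j → x ≢ just k
    k-free (inj₁ x≡i) _          x≡k = i≢k (just-injective (trans (sym x≡i) x≡k))
    k-free (inj₂ _)   (inj₁ x≡j) x≡k = j≢k (just-injective (trans (sym x≡j) x≡k))
    k-free (inj₂ y≡i) (inj₂ y≡j) _   = i≢j (just-injective (trans (sym y≡i) y≡j))

  third-avoidsʳ : ∀ x y → y ≢ just (third x y)
  third-avoidsʳ x y rewrite third-comm x y = third-avoidsˡ y x

  module Recoloring
    (F : ProperColoring d) (fixes : ∀ v a → a ∈ₗ triple i j k → color F v a ≡ a)
    (forbidden : Vertex d → Maybe (Fin d)) (forbidden-wd : ∀ v → forbidden v ≡ forbidden (flip i v))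
    where

    private
      colorI colorJ colorK : Vertex d → Fin d
      colorI v = third (forbidden v) (forbidden (flip j v))
      colorK v = third (just (colorI v)) (just (colorI (flip k v)))
      colorJ v = third (just (colorI v)) (just (colorK v))

      colorI-flipᵢ : ∀ v → colorI (flip i v) ≡ colorI v
      colorI-flipᵢ v = cong₂ third (sym (forbidden-wd v)) (begin
        forbidden (flip j (flip i v))  ≡⟨ cong forbidden (updateAt-commutes j i (≢-sym i≢j) v) ⟩
        forbidden (flip i (flip j v))  ≡⟨ sym (forbidden-wd (flip j v)) ⟩
        forbidden (flip j v)           ∎)
        where open ≡-Reasoning

      colorI-flipⱼ : ∀ v → colorI (flip j v) ≡ colorI v
      colorI-flipⱼ v rewrite flip-involutive j v = third-comm (forbidden (flip j v)) (forbidden v)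

      colorK-flipⱼ : ∀ v → colorK (flip j v) ≡ colorK v
      colorK-flipⱼ v = cong₂ (λ a b → third (just a) (just b)) (colorI-flipⱼ v) (begin
        colorI (flip k (flip j v))  ≡⟨ cong colorI (updateAt-commutes k j (≢-sym j≢k) v) ⟩
        colorI (flip j (flip k v))  ≡⟨ colorI-flipⱼ (flip k v) ⟩
        colorI (flip k v)           ∎)
        where open ≡-Reasoning

      colorK-flipₖ : ∀ v → colorK (flip k v) ≡ colorK v
      colorK-flipₖ v rewrite flip-involutive k v = third-comm (just (colorI (flip k v))) (just (colorI v))

      colorJ-flipⱼ : ∀ v → colorJ (flip j v) ≡ colorJ v
      colorJ-flipⱼ v = cong₂ (λ a b → third (just a) (just b)) (colorI-flipⱼ v) (colorK-flipⱼ v)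

      colorI≢colorJ : ∀ v → colorI v ≢ colorJ v
      colorI≢colorJ v = third-avoidsˡ (just (colorI v)) (just (colorK v)) ∘ cong just

      colorI≢colorK : ∀ v → colorI v ≢ colorK v
      colorI≢colorK v = third-avoidsˡ (just (colorI v)) (just (colorI (flip k v))) ∘ cong just

      colorJ≢colorK : ∀ v → colorJ v ≢ colorK v
      colorJ≢colorK v = third-avoidsʳ (just (colorI v)) (just (colorK v)) ∘ cong just ∘ sym

      colorI-∈ : ∀ v → colorI v ∈ₗ triple i j k
      colorI-∈ v = third-∈ (forbidden v) (forbidden (flip j v))

      colorJ-∈ : ∀ v → colorJ v ∈ₗ triple i j k
      colorJ-∈ v = third-∈ (just (colorI v)) (just (colorK v))

      colorK-∈ : ∀ v → colorK v ∈ₗ triple i j k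
      colorK-∈ v = third-∈ (just (colorI v)) (just (colorI (flip k v)))

      off-triple-avoids : ∀ v {l a} → l ∉ₗ triple i j k → a ∈ₗ triple i j k → color F v l ≢ a
      off-triple-avoids v {l} {a} l∉ a∈ l↦a =
        proper F v l a (λ l≡a → l∉ (subst (_∈ₗ triple i j k) (sym l≡a) a∈))
          (trans l↦a (sym (fixes v a a∈)))

      data Role (l : Fin d) : Set where
        dimI   : l ≡ i → Role l
        dimJ   : l ≡ j → Role l
        dimK   : l ≡ k → Role l
        dimOff : l ∉ₗ triple i j k → Role l

      role : ∀ l → Role l
      role l with l ∈? triple i j k
      ... | yes (here l≡i)                 = dimI l≡i
      ... | yes (there (here l≡j))         = dimJ l≡j
      ... | yes (there (there (here l≡k))) = dimK l≡k
      ... | no l∉                          = dimOff l∉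

      recolorAt : Vertex d → (l : Fin d) → Role l → Fin d
      recolorAt v l (dimI _)   = colorI v
      recolorAt v l (dimJ _)   = colorJ v
      recolorAt v l (dimK _)   = colorK v
      recolorAt v l (dimOff _) = color F v l

      recolorAt-wd : ∀ v l (r : Role l) → recolorAt v l r ≡ recolorAt (flip l v) l r
      recolorAt-wd v l (dimI refl) = sym (colorI-flipᵢ v)
      recolorAt-wd v l (dimJ refl) = sym (colorJ-flipⱼ v)
      recolorAt-wd v l (dimK refl) = sym (colorK-flipₖ v)
      recolorAt-wd v l (dimOff _)  = wellDefined F v l

      recolorAt-proper : ∀ v l m → l ≢ m → (r : Role l) (s : Role m) → recolorAt v l r ≢ recolorAt v m s
      recolorAt-proper v l m l≢m (dimI refl) (dimI refl) = ⊥-elim (l≢m refl)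
      recolorAt-proper v l m l≢m (dimJ refl) (dimJ refl) = ⊥-elim (l≢m refl)
      recolorAt-proper v l m l≢m (dimK refl) (dimK refl) = ⊥-elim (l≢m refl)
      recolorAt-proper v l m _ (dimI _) (dimJ _) = colorI≢colorJ v
      recolorAt-proper v l m _ (dimI _) (dimK _) = colorI≢colorK v
      recolorAt-proper v l m _ (dimJ _) (dimK _) = colorJ≢colorK v
      recolorAt-proper v l m _ (dimJ _) (dimI _) = ≢-sym (colorI≢colorJ v)
      recolorAt-proper v l m _ (dimK _) (dimI _) = ≢-sym (colorI≢colorK v)
      recolorAt-proper v l m _ (dimK _) (dimJ _) = ≢-sym (colorJ≢colorK v)
      recolorAt-proper v l m _ (dimOff l∉) (dimI _) = off-triple-avoids v l∉ (colorI-∈ v)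
      recolorAt-proper v l m _ (dimOff l∉) (dimJ _) = off-triple-avoids v l∉ (colorJ-∈ v)
      recolorAt-proper v l m _ (dimOff l∉) (dimK _) = off-triple-avoids v l∉ (colorK-∈ v)
      recolorAt-proper v l m _ (dimI _) (dimOff m∉) = ≢-sym (off-triple-avoids v m∉ (colorI-∈ v))
      recolorAt-proper v l m _ (dimJ _) (dimOff m∉) = ≢-sym (off-triple-avoids v m∉ (colorJ-∈ v))
      recolorAt-proper v l m _ (dimK _) (dimOff m∉) = ≢-sym (off-triple-avoids v m∉ (colorK-∈ v))
      recolorAt-proper v l m l≢m (dimOff _) (dimOff _) = proper F v l m l≢m

      recolorAt-i : ∀ v (r : Role i) → recolorAt v i r ≡ colorI v
      recolorAt-i v (dimI _)     = refl
      recolorAt-i v (dimJ i≡j)   = ⊥-elim (i≢j i≡j)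
      recolorAt-i v (dimK i≡k)   = ⊥-elim (i≢k i≡k)
      recolorAt-i v (dimOff i∉)  = ⊥-elim (i∉ (here refl))

      recolorAt-off : ∀ v {l} (r : Role l) → l ∉ₗ triple i j k → recolorAt v l r ≡ color F v l
      recolorAt-off v (dimI l≡i) l∉ = ⊥-elim (l∉ (here l≡i))
      recolorAt-off v (dimJ l≡j) l∉ = ⊥-elim (l∉ (there (here l≡j)))
      recolorAt-off v (dimK l≡k) l∉ = ⊥-elim (l∉ (there (there (here l≡k))))
      recolorAt-off v (dimOff _) _  = refl

    recolored : ProperColoring d
    recolored = record
      { color       = λ v l → recolorAt v l (role l)
      ; wellDefined = λ v l → recolorAt-wd v l (role l)
      ; proper      = λ v l m l≢m → recolorAt-proper v l m l≢m (role l) (role m)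
      }

    recolored-off : ∀ v l → l ∉ₗ triple i j k → color recolored v l ≡ color F v l
    recolored-off v l = recolorAt-off v (role l)

    recolored-avoids : ∀ v → forbidden v ≢ just (color recolored v i)
    recolored-avoids v rewrite recolorAt-i v (role i) = third-avoidsˡ (forbidden v) (forbidden (flip j v))

Triple : Set → Set
Triple A = A × A × A

entries : ∀ {A : Set} → List (Triple A) → List A
entries []                  = []
entries ((x , y , z) ∷ ts) = x ∷ y ∷ z ∷ entries ts

heads : ∀ {A : Set} → List (Triple A) → List A
heads = map proj₁

∈-heads⇒∈-entries : ∀ {A : Set} {x : A} ts → x ∈ₗ heads ts → x ∈ₗ entries ts
∈-heads⇒∈-entries (_ ∷ _)  (here x≡)  = here x≡
∈-heads⇒∈-entries (_ ∷ ts) (there x∈) = there (there (there (∈-heads⇒∈-entries ts x∈)))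

module _ {d : ℕ} (φ : PartialColoring d) (φ-wd : WellDefinedOnEdges φ) where

  record AvoidingColoring (T : List (Triple (Fin d))) : Set where
    field
      coloring    : ProperColoring d
      identity-off : ∀ v l → l ∉ₗ entries T → color coloring v l ≡ l
      avoids-heads : ∀ v l → l ∈ₗ heads T → φ v l ≢ just (color coloring v l)

  avoid-on-heads : (T : List (Triple (Fin d))) → Unique (entries T) → AvoidingColoring T
  avoid-on-heads [] _ = record
    { coloring    = identityColoring
    ; identity-off = λ _ _ _ → refl
    ; avoids-heads = λ _ _ ()
    }
  avoid-on-heads ((i , j , k) ∷ T) ((i≢j ∷ i≢k ∷ i∉T) ∷ (j≢k ∷ j∉T) ∷ k∉T ∷ T-unique) = record
    { coloring    = recolored
    -- i ∷ j ∷ k ∷ entries T computes to triple i j k ++ entries T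
    ; identity-off = λ v l l∉ →
        trans (recolored-off v l (l∉ ∘ ∈-++⁺ˡ)) (F-identity-off v l (l∉ ∘ ∈-++⁺ʳ (triple i j k)))
    ; avoids-heads = avoids
    }
    where
    open AvoidingColoring (avoid-on-heads T T-unique)
      renaming (coloring to F; identity-off to F-identity-off; avoids-heads to F-avoids-heads)

    fresh : ∀ {a} → a ∈ₗ triple i j k → a ∉ₗ entries T
    fresh (here refl)                 = All¬⇒¬Any i∉T
    fresh (there (here refl))         = All¬⇒¬Any j∉T
    fresh (there (there (here refl))) = All¬⇒¬Any k∉T

    open Recoloring i≢j i≢k j≢k F (λ v a a∈ → F-identity-off v a (fresh a∈))
      (λ v → φ v i) (λ v → φ-wd v i)

    avoids : ∀ v l → l ∈ₗ i ∷ heads T → φ v l ≢ just (color recolored v l)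
    avoids v l (here refl) = recolored-avoids v
    avoids v l (there l∈) rewrite recolored-off v l (λ l∈t → fresh l∈t (∈-heads⇒∈-entries T l∈)) =
      F-avoids-heads v l l∈

triples : ∀ {A : Set} → List A → List A → List (Triple A)
triples (x ∷ xs) (y ∷ z ∷ ys) = (x , y , z) ∷ triples xs ys
triples _        _            = []

heads-triples : ∀ {A : Set} (xs ys : List A) →
  length xs * 2 ≤ length ys → heads (triples xs ys) ≡ xs
heads-triples []       _            _               = refl
heads-triples (x ∷ xs) (_ ∷ _ ∷ ys) (s≤s (s≤s le)) = cong (x ∷_) (heads-triples xs ys le)

triples-fresh : ∀ {A : Set} {a : A} xs ys →
  All (a ≢_) xs → All (a ≢_) ys → All (a ≢_) (entries (triples xs ys))
triples-fresh (_ ∷ xs) (_ ∷ _ ∷ ys) (a≢x ∷ a∉xs) (a≢y ∷ a≢z ∷ a∉ys) =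
  a≢x ∷ a≢y ∷ a≢z ∷ triples-fresh xs ys a∉xs a∉ys
triples-fresh []       _            _ _ = []
triples-fresh (_ ∷ _)  []           _ _ = []
triples-fresh (_ ∷ _)  (_ ∷ [])     _ _ = []

triples-unique : ∀ {A : Set} (xs ys : List A) → Unique xs → Unique ys → Disjoint xs ys →
  Unique (entries (triples xs ys))
triples-unique (x ∷ xs) (y ∷ z ∷ ys) (x∉xs ∷ xs-unique) ((y≢z ∷ y∉ys) ∷ z∉ys ∷ ys-unique) disjoint =
  (x≢y ∷ x≢z ∷ fresh x∉xs x∉ys) ∷ (y≢z ∷ fresh y∉xs y∉ys) ∷ fresh z∉xs z∉ys
    ∷ triples-unique xs ys xs-unique ys-unique (λ (p , q) → disjoint (there p , there (there q)))
  where
  fresh : ∀ {a} → All (a ≢_) xs → All (a ≢_) ys → All (a ≢_) (entries (triples xs ys))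
  fresh = triples-fresh xs ys

  x≢y : x ≢ y
  x≢y x≡y = disjoint (here refl , here x≡y)

  x≢z : x ≢ z
  x≢z x≡z = disjoint (here refl , there (here x≡z))

  x∉ys : All (x ≢_) ys
  x∉ys = ¬Any⇒All¬ ys (λ x∈ys → disjoint (here refl , there (there x∈ys)))

  y∉xs : All (y ≢_) xs
  y∉xs = ¬Any⇒All¬ xs (λ y∈xs → disjoint (there y∈xs , here refl))

  z∉xs : All (z ≢_) xs
  z∉xs = ¬Any⇒All¬ xs (λ z∈xs → disjoint (there z∈xs , there (here refl)))
triples-unique []      _        _ _ _ = []
triples-unique (_ ∷ _) []       _ _ _ = []
triples-unique (_ ∷ _) (_ ∷ []) _ _ _ = []

members : ∀ {n} → Subset n → List (Fin n)
members []            = []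
members (inside ∷ p)  = zero ∷ map suc (members p)
members (outside ∷ p) = map suc (members p)

∈-members⁺ : ∀ {n} {p : Subset n} {x} → x ∈ p → x ∈ₗ members p
∈-members⁺ {p = inside ∷ _}  here        = here refl
∈-members⁺ {p = inside ∷ _}  (there x∈p) = there (∈-map⁺ suc (∈-members⁺ x∈p))
∈-members⁺ {p = outside ∷ _} (there x∈p) = ∈-map⁺ suc (∈-members⁺ x∈p)

∈-members⁻ : ∀ {n} (p : Subset n) {x} → x ∈ₗ members p → x ∈ p
∈-members⁻ (inside ∷ p) (here refl) = here
∈-members⁻ (inside ∷ p) (there x∈) with ∈-map⁻ suc x∈
... | _ , y∈ , refl = there (∈-members⁻ p y∈)
∈-members⁻ (outside ∷ p) x∈ with ∈-map⁻ suc x∈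
... | _ , y∈ , refl = there (∈-members⁻ p y∈)

members-unique : ∀ {n} (p : Subset n) → Unique (members p)
members-unique []            = []
members-unique (inside ∷ p)  =
  All.map⁺ (universal (λ _ ()) (members p)) ∷ Unique.map⁺ suc-injective (members-unique p)
members-unique (outside ∷ p) = Unique.map⁺ suc-injective (members-unique p)

length-members : ∀ {n} (p : Subset n) → length (members p) ≡ ∣ p ∣
length-members []            = refl
length-members (inside ∷ p)  = cong ℕ.suc (trans (length-map suc (members p)) (length-members p))
length-members (outside ∷ p) = trans (length-map suc (members p)) (length-members p)

m≤n/3⇒m*2≤n∸m : ∀ {m n} → m ≤ n / 3 → m * 2 ≤ n ∸ m
m≤n/3⇒m*2≤n∸m {m} {n} m≤n/3 = m+n≤o⇒m≤o∸n (m * 2) (begin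
  m * 2 + m  ≡⟨ +-comm (m * 2) m ⟩
  m + m * 2  ≡⟨ *-suc m 2 ⟨
  m * 3      ≤⟨ *-monoˡ-≤ 3 m≤n/3 ⟩
  n / 3 * 3  ≤⟨ m/n*n≤m n 3 ⟩
  n          ∎)
  where open ≤-Reasoning

covering-triples : ∀ {d} (S : Subset d) → ∣ S ∣ ≤ d / 3 →
  Σ[ T ∈ List (Triple (Fin d)) ] Unique (entries T) × (∀ {i} → i ∈ S → i ∈ₗ heads T)
covering-triples {d} S ∣S∣≤d/3 =
  triples (members S) (members (∁ S)) ,
  triples-unique _ _ (members-unique S) (members-unique (∁ S))
    (λ (x∈S , x∈∁S) → x∈p⇒x∉∁p (∈-members⁻ S x∈S) (∈-members⁻ (∁ S) x∈∁S)) ,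
  λ {i} i∈S → subst (i ∈ₗ_) (sym (heads-triples _ _ enough)) (∈-members⁺ i∈S)
  where
  enough : length (members S) * 2 ≤ length (members (∁ S))
  enough = begin
    length (members S) * 2     ≡⟨ cong (_* 2) (length-members S) ⟩
    ∣ S ∣ * 2                  ≤⟨ m≤n/3⇒m*2≤n∸m ∣S∣≤d/3 ⟩
    d ∸ ∣ S ∣                  ≡⟨ ∣∁p∣≡n∸∣p∣ S ⟨
    ∣ ∁ S ∣                    ≡⟨ length-members (∁ S) ⟨
    length (members (∁ S))     ∎
    where open ≤-Reasoning

corollary4p6 : (d : ℕ) (φ : PartialColoring d) → WellDefinedOnEdges φ →
    (S : Subset d) → ∣ S ∣ ≤ d / 3 →
    (∀ (v : Vertex d) (i : Fin d) (c : Fin d) → φ v i ≡ just c → i ∈ S) →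
    Avoidable φ
corollary4p6 d φ φ-wd S ∣S∣≤d/3 colored⊆S
  with T , T-unique , S⊆heads ← covering-triples S ∣S∣≤d/3 =
  color coloring , wellDefined coloring , proper coloring ,
  λ v i c φvi≡c color≡c →
    avoids-heads v i (S⊆heads (colored⊆S v i c φvi≡c)) (trans φvi≡c (cong just (sym color≡c)))
  where open AvoidingColoring (avoid-on-heads φ φ-wd T T-unique)
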